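{- Let $n\ge 2$ and let $H_n=[h_{ij}]$ be the $n\times n$ tridiagonal matrix with $h_{11}=3$, $h_{ii}=1$ for $2\le i\le n$, $h_{i+1,i}=1$ and $h_{i,i+1}=2$ for $1\le i\le n-1$, and all other entries $0$. Define $H_n^{(0)}=H_n$ and, for $1\le r\le n-2$, let $H_n^{(r)}$ be the contraction of $H_n^{(r-1)}$ on column $1$ relative to rows $1$ and $2$. Then $$\operatorname{per}H_n=\operatorname{per}H_n^{(n-2)}=J_{n+2},$$ where $J_m$ denotes the $m$th Jacobsthal number.
   Context: The Jacobsthal numbers are defined by $J_0=0$, $J_1=1$, $J_{m+2}=J_{m+1}+2J_m$ for $m\ge 0$. The permanent of an $n\times n$ matrix $A=[a_{ij}]$ is $\operatorname{per}A=\sum_{\sigma\in S_n}\prod_{i=1}^n a_{i\sigma(i)}$. Contraction: if column $k$ of a matrix $A$ (with rows $r_1,\dots,r_m$) contains exactly two nonzero entries $a_{ik}$ and $a_{jk}$ ($i\ne j$), the contraction of $A$ on column $k$ relative to rows $i$ and $j$ is the $(m-1)\times(n-1)$ matrix obtained from $A$ by replacing row $i$ with $a_{jk}r_i+a_{ik}r_j$ and deleting row $j$ and column $k$. ($H_n$ is the adjacency matrix of a certain directed pseudo graph.) -}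

module Defs where

open import Data.Nat using (ℕ; zero; suc; _+_; _*_; _≡ᵇ_)
open import Data.Fin using (Fin; zero; suc; toℕ)
open import Data.Fin.Properties using (_≟_)
open import Data.Bool using (Bool; true; false; _∧_; _∨_; not; if_then_else_)
open import Data.List using (List; []; _∷_; map; concatMap; allFin; filterᵇ)
open import Data.Nat.ListAction using (sum; product)
open import Data.Bool.ListAction using (and)
open import Relation.Nullary.Decidable using (⌊_⌋)

J : ℕ → ℕ
J zero = 0
J (suc zero) = 1
J (suc (suc m)) = J (suc m) + 2 * J m

-- n × n matrices with natural-number entries (indices 0-based)
Mat : ℕ → Set
Mat n = Fin n → Fin n → ℕ

consF : ∀ {n m} → Fin m → (Fin n → Fin m) → (Fin (suc n) → Fin m)
consF x f zero = x
consF x f (suc i) = f i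

allFuns : ∀ n m → List (Fin n → Fin m)
allFuns zero m = (λ ()) ∷ []
allFuns (suc n) m = concatMap (λ f → map (λ x → consF x f) (allFin m)) (allFuns n m)

isInjective : ∀ {n m} → (Fin n → Fin m) → Bool
isInjective {n} f =
  and (concatMap (λ i → map (λ j → not ⌊ f i ≟ f j ⌋ ∨ ⌊ i ≟ j ⌋) (allFin n)) (allFin n))

-- the symmetric group S_n, as the list of all bijections Fin n → Fin n
perms : ∀ n → List (Fin n → Fin n)
perms n = filterᵇ isInjective (allFuns n n)

per : ∀ {n} → Mat n → ℕ
per {n} A = sum (map (λ σ → product (map (λ i → A i (σ i)) (allFin n))) (perms n))

H : ∀ n → Mat n
H n i j =
  if ⌊ i ≟ j ⌋ then (if toℕ i ≡ᵇ 0 then 3 else 1)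
  else if toℕ i ≡ᵇ suc (toℕ j) then 1
  else if toℕ j ≡ᵇ suc (toℕ i) then 2
  else 0

-- contraction on column 1 relative to rows 1 and 2 (0-based: column 0, rows 0,1):
-- row 1 becomes a_{21} r_1 + a_{11} r_2, then row 2 and column 1 are deleted.
contract : ∀ {m} → Mat (suc (suc m)) → Mat (suc m)
contract A zero j = A (suc zero) zero * A zero (suc j) + A zero zero * A (suc zero) (suc j)
contract A (suc i) j = A (suc (suc i)) (suc j)

-- For a (k+2)×(k+2) matrix A, contractAll A = A^{(k)}, where A^{(0)} = A and
-- A^{(r)} = contract A^{(r-1)}.
contractAll : ∀ {k} → Mat (suc (suc k)) → Mat 2
contractAll {zero} A = A
contractAll {suc k} A = contractAll (contract A)

{-# OPTIONS --safe #-}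
module Submission where

-- Expand the permanent of H_n row by row (indices from 0).  Row i of H_n only meets columns
-- i-1, i, i+1, so once rows 0, …, r-1 are placed the used columns are either {0, …, r-1} or
-- {0, …, r-2, r}; any other pattern leaves a column that no later row reaches.  With k rows
-- left these two states contribute p_k and q_k, where p_{k+1} = p_k + 2 q_k and q_{k+1} = p_k,
-- so p_k = J_{k+1}, and row 0 gives per H_n = 3 J_n + 2 J_{n-1} = J_{n+2}.
-- Contracting on the first column keeps the tridiagonal rows below the first one and turns a
-- first row (α, β, 0, …) into (α + β, 2α, 0, …).  Starting from (3, 2) = (J_3, 2 J_2) this runs
-- through (J_{r+3}, 2 J_{r+2}), and the final 2×2 matrix has permanent J_{n+1} + 2 J_n = J_{n+2}.

open import Defs
open import Data.Nat using (ℕ; zero; suc; _+_; _*_; _≡ᵇ_; _≤_; _<_; z≤n; s≤s)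
open import Data.Nat.Properties
  using (*-zeroʳ; *-identityˡ; *-identityʳ; *-comm; +-identityʳ; +-suc; +-comm; *-distribˡ-+
        ; ≤-refl; n≤1+n; n<1+n; m<n⇒m<1+n; <⇒≢; <⇒≱; ≤-trans; ≤-reflexive; <-trans; m≤n+m
        ; +-commutativeSemigroup)
  renaming (_≟_ to _≟ℕ_)
open import Data.Nat.ListAction using (sum; product)
open import Data.Nat.ListAction.Properties using (sum-++)
open import Data.Nat.Solver using (module +-*-Solver)
open import Data.Fin using (Fin; zero; suc; toℕ)
open import Data.Fin.Properties using (_≟_)
open import Data.Bool using (Bool; true; false; _∧_; _∨_; not; if_then_else_)
open import Data.Bool.Properties
  using (∨-zeroʳ; ∨-identityʳ; ∧-zeroʳ; ∧-identityʳ; ∧-assoc; ∧-idem; ∨-∧-booleanAlgebra)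
open import Data.Bool.ListAction using (and; all)
open import Data.Bool.Solver using (module ∨-∧-Solver)
open import Data.List using (List; []; _∷_; map; concatMap; allFin; filterᵇ; _++_)
open import Data.List.Properties using (map-cong; map-tabulate; map-++; map-∘)
open import Data.Product using (_×_; _,_)
open import Function using (_∘_; id)
open import Relation.Nullary.Decidable using (⌊_⌋; ⌊⌋-map′; dec-true; dec-false)
open import Relation.Binary.PropositionalEquality
  using (_≡_; _≢_; refl; sym; trans; cong; cong₂; _≗_; module ≡-Reasoning)
open import Algebra.Properties.CommutativeSemigroup +-commutativeSemigroup using (interchange)
open import Algebra.Lattice.Properties.BooleanAlgebra ∨-∧-booleanAlgebra using (deMorgan₂)

open ≡-Reasoning

private
  variable
    A B : Set

sum-map-concatMap : (w : B → ℕ) (f : A → List B) (xs : List A) →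
  sum (map w (concatMap f xs)) ≡ sum (map (λ a → sum (map w (f a))) xs)
sum-map-concatMap w f [] = refl
sum-map-concatMap w f (a ∷ xs) = begin
  sum (map w (f a ++ concatMap f xs))              ≡⟨ cong sum (map-++ w (f a) _) ⟩
  sum (map w (f a) ++ map w (concatMap f xs))      ≡⟨ sum-++ (map w (f a)) _ ⟩
  sum (map w (f a)) + sum (map w (concatMap f xs)) ≡⟨ cong (sum (map w (f a)) +_) (sum-map-concatMap w f xs) ⟩
  sum (map w (f a)) + sum (map (λ a → sum (map w (f a))) xs) ∎

sum-map-+ : (f g : A → ℕ) (xs : List A) →
  sum (map (λ a → f a + g a) xs) ≡ sum (map f xs) + sum (map g xs)
sum-map-+ f g [] = refl
sum-map-+ f g (a ∷ xs) =
  trans (cong (f a + g a +_) (sum-map-+ f g xs)) (interchange (f a) (g a) _ _)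

sum-map-0 : (xs : List A) → sum (map (λ _ → 0) xs) ≡ 0
sum-map-0 [] = refl
sum-map-0 (_ ∷ xs) = sum-map-0 xs

sum-map-*ˡ : (c : ℕ) (f : A → ℕ) (xs : List A) → sum (map (λ a → c * f a) xs) ≡ c * sum (map f xs)
sum-map-*ˡ c f [] = sym (*-zeroʳ c)
sum-map-*ˡ c f (a ∷ xs) = trans (cong (c * f a +_) (sum-map-*ˡ c f xs)) (sym (*-distribˡ-+ c (f a) _))

sum-map-swap : (f : A → B → ℕ) (xs : List A) (ys : List B) →
  sum (map (λ a → sum (map (f a) ys)) xs) ≡ sum (map (λ b → sum (map (λ a → f a b) xs)) ys)
sum-map-swap f [] ys = sym (sum-map-0 ys)
sum-map-swap f (a ∷ xs) ys =
  trans (cong (sum (map (f a) ys) +_) (sum-map-swap f xs ys)) (sym (sum-map-+ (f a) _ ys))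

sum-map-filterᵇ : (p : A → Bool) (w : A → ℕ) (xs : List A) →
  sum (map w (filterᵇ p xs)) ≡ sum (map (λ a → if p a then w a else 0) xs)
sum-map-filterᵇ p w [] = refl
sum-map-filterᵇ p w (x ∷ xs) with p x
... | true  = cong (w x +_) (sum-map-filterᵇ p w xs)
... | false = sum-map-filterᵇ p w xs

all-concatMap : (f : A → List Bool) (xs : List A) → and (concatMap f xs) ≡ all (and ∘ f) xs
all-concatMap f [] = refl
all-concatMap f (a ∷ xs) = trans (and-++ (f a) _) (cong (and (f a) ∧_) (all-concatMap f xs))
  where
  and-++ : ∀ bs cs → and (bs ++ cs) ≡ and bs ∧ and cs
  and-++ []          cs = refl
  and-++ (true ∷ bs) cs = and-++ bs cs
  and-++ (false ∷ bs) cs = refl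

all-∧ : (p q : A → Bool) (xs : List A) → all (λ a → p a ∧ q a) xs ≡ all p xs ∧ all q xs
all-∧ p q [] = refl
all-∧ p q (a ∷ xs) with p a | q a
... | true  | true  = all-∧ p q xs
... | true  | false = sym (∧-zeroʳ (all p xs))
... | false | _     = refl

all-true : (xs : List A) → all (λ _ → true) xs ≡ true
all-true [] = refl
all-true (_ ∷ xs) = all-true xs

all-cong : {p q : A → Bool} → p ≗ q → (xs : List A) → all p xs ≡ all q xs
all-cong p≗q xs = cong and (map-cong p≗q xs)

map-allFin-suc : ∀ n (g : Fin (suc n) → A) → map g (allFin (suc n)) ≡ g zero ∷ map (g ∘ suc) (allFin n)
map-allFin-suc n g = cong (g zero ∷_) (trans (map-tabulate suc g) (sym (map-tabulate id (g ∘ suc))))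

sumTo : ℕ → (ℕ → ℕ) → ℕ
sumTo zero    f = 0
sumTo (suc n) f = f 0 + sumTo n (f ∘ suc)

sum-allFin : ∀ n (f : ℕ → ℕ) → sum (map (f ∘ toℕ) (allFin n)) ≡ sumTo n f
sum-allFin zero    f = refl
sum-allFin (suc n) f = trans (cong sum (map-allFin-suc n (f ∘ toℕ))) (cong (f 0 +_) (sum-allFin n (f ∘ suc)))

sumTo-cong : ∀ n {f g : ℕ → ℕ} → f ≗ g → sumTo n f ≡ sumTo n g
sumTo-cong zero    f≗g = refl
sumTo-cong (suc n) f≗g = cong₂ _+_ (f≗g 0) (sumTo-cong n (f≗g ∘ suc))

sumTo-0 : ∀ n {f : ℕ → ℕ} → (∀ x → f x ≡ 0) → sumTo n f ≡ 0
sumTo-0 zero    f≡0 = refl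
sumTo-0 (suc n) f≡0 = cong₂ _+_ (f≡0 0) (sumTo-0 n (f≡0 ∘ suc))

sumTo-skip : ∀ a c {f : ℕ → ℕ} → (∀ x → x < a → f x ≡ 0) → sumTo (a + c) f ≡ sumTo c (λ y → f (a + y))
sumTo-skip zero    c f<a≡0 = refl
sumTo-skip (suc a) c f<a≡0 =
  cong₂ _+_ (f<a≡0 0 (s≤s z≤n)) (sumTo-skip a c (λ x x<a → f<a≡0 (suc x) (s≤s x<a)))

sumTo-truncate : ∀ w b (f : ℕ → ℕ) → (∀ y → f (w + y) ≡ 0) → sumTo (w + b) f ≡ sumTo w f
sumTo-truncate zero    b f f≥w≡0 = sumTo-0 b f≥w≡0
sumTo-truncate (suc w) b f f≥w≡0 = cong (f 0 +_) (sumTo-truncate w b (f ∘ suc) f≥w≡0)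

≡ᵇ-refl : ∀ x → (x ≡ᵇ x) ≡ true
≡ᵇ-refl x = dec-true (x ≟ℕ x) refl

≢⇒≡ᵇ-false : ∀ {x y} → x ≢ y → (x ≡ᵇ y) ≡ false
≢⇒≡ᵇ-false {x} {y} = dec-false (x ≟ℕ y)

zeroIf : Bool → ℕ → ℕ
zeroIf b v = if b then 0 else v

insert : (ℕ → Bool) → ℕ → (ℕ → Bool)
insert U x y = U y ∨ (y ≡ᵇ x)

-- Places rows r, …, r+k-1 of A, one after the other, in distinct columns below m
-- outside the set U of columns already used.
mutual
  rowExpansion : (m k : ℕ) → (ℕ → ℕ → ℕ) → ℕ → (ℕ → Bool) → ℕ
  rowExpansion m zero    A r U = 1
  rowExpansion m (suc k) A r U = sumTo m (expansionTerm m k A r U)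

  expansionTerm : (m k : ℕ) → (ℕ → ℕ → ℕ) → ℕ → (ℕ → Bool) → ℕ → ℕ
  expansionTerm m k A r U x = zeroIf (U x) (A r x * rowExpansion m k A (suc r) (insert U x))

expansionTerm-used : ∀ m k A r U x → U x ≡ true → expansionTerm m k A r U x ≡ 0
expansionTerm-used m k A r U x Ux =
  cong (λ b → zeroIf b (A r x * rowExpansion m k A (suc r) (insert U x))) Ux

expansionTerm-free : ∀ m k A r U x → U x ≡ false →
  expansionTerm m k A r U x ≡ A r x * rowExpansion m k A (suc r) (insert U x)
expansionTerm-free m k A r U x Ux =
  cong (λ b → zeroIf b (A r x * rowExpansion m k A (suc r) (insert U x))) Ux

expansionTerm-entry≡0 : ∀ m k A r U x → A r x ≡ 0 → expansionTerm m k A r U x ≡ 0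
expansionTerm-entry≡0 m k A r U x Arx≡0 with U x
... | true  = refl
... | false = cong (_* rowExpansion m k A (suc r) (insert U x)) Arx≡0

expansionTerm-rest≡0 : ∀ m k A r U x → rowExpansion m k A (suc r) (insert U x) ≡ 0 →
  expansionTerm m k A r U x ≡ 0
expansionTerm-rest≡0 m k A r U x rest≡0 with U x
... | true  = refl
... | false = trans (cong (A r x *_) rest≡0) (*-zeroʳ (A r x))

insert-self : ∀ U x → insert U x x ≡ true
insert-self U x = trans (cong (U x ∨_) (≡ᵇ-refl x)) (∨-zeroʳ (U x))

insert-other : ∀ U {x y} → y ≢ x → insert U x y ≡ U y
insert-other U {x} {y} y≢x = trans (cong (U y ∨_) (≢⇒≡ᵇ-false y≢x)) (∨-identityʳ (U y))

FreeAbove : ℕ → (ℕ → Bool) → Set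
FreeAbove r U = ∀ y → r < y → U y ≡ false

FreeAbove-suc : ∀ {r U} → FreeAbove r U → FreeAbove (suc r) U
FreeAbove-suc free y r<y = free y (<-trans (n<1+n _) r<y)

insert-FreeAbove : ∀ {r U x} → x ≤ r → FreeAbove r U → FreeAbove r (insert U x)
insert-FreeAbove {U = U} x≤r free y r<y =
  trans (insert-other U (λ y≡x → <⇒≱ r<y (≤-trans (≤-reflexive y≡x) x≤r))) (free y r<y)

toMat : ∀ {n} → (ℕ → ℕ → ℕ) → Mat n
toMat A i j = A (toℕ i) (toℕ j)

≟-toℕ : ∀ {n} (a b : Fin n) → ⌊ a ≟ b ⌋ ≡ (toℕ a ≡ᵇ toℕ b)
≟-toℕ zero    zero    = refl
≟-toℕ zero    (suc b) = refl
≟-toℕ (suc a) zero    = refl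
≟-toℕ (suc a) (suc b) = trans (⌊⌋-map′ _ _ (a ≟ b)) (≟-toℕ a b)

≟-sym : ∀ {n} (a b : Fin n) → ⌊ a ≟ b ⌋ ≡ ⌊ b ≟ a ⌋
≟-sym zero    zero    = refl
≟-sym zero    (suc b) = refl
≟-sym (suc a) zero    = refl
≟-sym (suc a) (suc b) = trans (⌊⌋-map′ _ _ (a ≟ b)) (trans (≟-sym a b) (sym (⌊⌋-map′ _ _ (b ≟ a))))

module _ {k m : ℕ} where

  misses : Fin m → (Fin k → Fin m) → Bool
  misses x g = all (λ i → not ⌊ g i ≟ x ⌋) (allFin k)

  avoids : (ℕ → Bool) → (Fin k → Fin m) → Bool
  avoids U g = all (λ i → not (U (toℕ (g i)))) (allFin k)

  rowProduct : (ℕ → ℕ → ℕ) → ℕ → (Fin k → Fin m) → ℕ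
  rowProduct A r g = product (map (λ i → A (r + toℕ i) (toℕ (g i))) (allFin k))

  weight : (ℕ → ℕ → ℕ) → ℕ → (ℕ → Bool) → (Fin k → Fin m) → ℕ
  weight A r U g = if isInjective g ∧ avoids U g then rowProduct A r g else 0

  avoids-insert : ∀ U x (g : Fin k → Fin m) → avoids (insert U (toℕ x)) g ≡ avoids U g ∧ misses x g
  avoids-insert U x g = trans
    (all-cong (λ i → trans (deMorgan₂ (U (toℕ (g i))) (toℕ (g i) ≡ᵇ toℕ x))
                           (cong (λ b → not (U (toℕ (g i))) ∧ not b) (sym (≟-toℕ (g i) x))))
              (allFin k))
    (all-∧ (λ i → not (U (toℕ (g i)))) (λ i → not ⌊ g i ≟ x ⌋) (allFin k))

module _ {k m : ℕ} (x : Fin m) (g : Fin k → Fin m) where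

  isInjective-consF : isInjective (consF x g) ≡ misses x g ∧ isInjective g
  isInjective-consF = begin
    isInjective f
      ≡⟨ all-concatMap (λ i → map (c i) (allFin (suc k))) (allFin (suc k)) ⟩
    all (λ i → all (c i) (allFin (suc k))) (allFin (suc k))
      ≡⟨ cong and (map-allFin-suc k (λ i → all (c i) (allFin (suc k)))) ⟩
    all (c zero) (allFin (suc k)) ∧ all (λ i → all (c (suc i)) (allFin (suc k))) (allFin k)
      ≡⟨ cong₂ _∧_ (cong and (map-allFin-suc k (c zero)))
                   (all-cong (λ i → cong and (map-allFin-suc k (c (suc i)))) (allFin k)) ⟩
    (c zero zero ∧ all (c zero ∘ suc) (allFin k))
      ∧ all (λ i → c (suc i) zero ∧ all (c (suc i) ∘ suc) (allFin k)) (allFin k)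
      ≡⟨ cong₂ _∧_ (cong₂ _∧_ (∨-zeroʳ _) (all-cong first-row (allFin k))) (all-∧ _ _ (allFin k)) ⟩
    misses x g
      ∧ (all (λ i → c (suc i) zero) (allFin k) ∧ all (λ i → all (c (suc i) ∘ suc) (allFin k)) (allFin k))
      ≡⟨ cong₂ (λ b d → misses x g ∧ (b ∧ d)) (all-cong (λ i → ∨-identityʳ _) (allFin k))
                                                (sym tail-rows) ⟩
    misses x g ∧ (misses x g ∧ isInjective g)
      ≡⟨ sym (∧-assoc (misses x g) _ _) ⟩
    (misses x g ∧ misses x g) ∧ isInjective g
      ≡⟨ cong (_∧ isInjective g) (∧-idem (misses x g)) ⟩
    misses x g ∧ isInjective g ∎
    where
    f : Fin (suc k) → Fin m
    f = consF x g
    c : Fin (suc k) → Fin (suc k) → Bool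
    c i j = not ⌊ f i ≟ f j ⌋ ∨ ⌊ i ≟ j ⌋
    tail-rows : isInjective g ≡ all (λ i → all (c (suc i) ∘ suc) (allFin k)) (allFin k)
    tail-rows = trans (all-concatMap (λ i → map (λ j → not ⌊ g i ≟ g j ⌋ ∨ ⌊ i ≟ j ⌋) (allFin k)) (allFin k))
      (all-cong (λ i → all-cong (λ j → cong (not ⌊ g i ≟ g j ⌋ ∨_) (sym (⌊⌋-map′ _ _ (i ≟ j)))) (allFin k))
                (allFin k))
    first-row : ∀ j → c zero (suc j) ≡ not ⌊ g j ≟ x ⌋
    first-row j = trans (∨-identityʳ _) (cong not (≟-sym x (g j)))

  avoids-consF : ∀ U → avoids U (consF x g) ≡ not (U (toℕ x)) ∧ avoids U g
  avoids-consF U = cong and (map-allFin-suc k (λ i → not (U (toℕ (consF x g i)))))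

  rowProduct-consF : ∀ A r → rowProduct A r (consF x g) ≡ A r (toℕ x) * rowProduct A (suc r) g
  rowProduct-consF A r = trans (cong product (map-allFin-suc k (λ i → A (r + toℕ i) (toℕ (consF x g i)))))
    (cong₂ _*_ (cong (λ s → A s (toℕ x)) (+-identityʳ r))
               (cong product (map-cong (λ i → cong (λ s → A s (toℕ (g i))) (+-suc r (toℕ i))) (allFin k))))

  weight-consF : ∀ A r U →
    weight A r U (consF x g) ≡ zeroIf (U (toℕ x)) (A r (toℕ x) * weight A (suc r) (insert U (toℕ x)) g)
  weight-consF A r U = begin
    weight A r U (consF x g)
      ≡⟨ cong₂ (λ b p → if b then p else 0) guard (rowProduct-consF A r) ⟩
    (if not u ∧ (isInjective g ∧ avoids (insert U (toℕ x)) g) then a * rowProduct A (suc r) g else 0)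
      ≡⟨ if-not-∧ u _ ⟩
    zeroIf u (a * weight A (suc r) (insert U (toℕ x)) g) ∎
    where
    u : Bool
    u = U (toℕ x)
    a : ℕ
    a = A r (toℕ x)
    open ∨-∧-Solver
    guard : isInjective (consF x g) ∧ avoids U (consF x g)
          ≡ not u ∧ (isInjective g ∧ avoids (insert U (toℕ x)) g)
    guard = begin
      isInjective (consF x g) ∧ avoids U (consF x g)
        ≡⟨ cong₂ _∧_ isInjective-consF (avoids-consF U) ⟩
      (misses x g ∧ isInjective g) ∧ (not u ∧ avoids U g)
        ≡⟨ solve 4 (λ mi inj nu av → (mi :* inj) :* (nu :* av) := nu :* (inj :* (av :* mi)))
                 refl (misses x g) (isInjective g) (not u) (avoids U g) ⟩
      not u ∧ (isInjective g ∧ (avoids U g ∧ misses x g))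
        ≡⟨ cong (λ b → not u ∧ (isInjective g ∧ b)) (sym (avoids-insert U x g)) ⟩
      not u ∧ (isInjective g ∧ avoids (insert U (toℕ x)) g) ∎
    if-not-∧ : ∀ c b {p} → (if not c ∧ b then a * p else 0) ≡ zeroIf c (a * (if b then p else 0))
    if-not-∧ true  b     = refl
    if-not-∧ false true  = refl
    if-not-∧ false false = sym (*-zeroʳ a)

sum-weight≡rowExpansion : ∀ k m A r U → sum (map (weight {k} {m} A r U) (allFuns k m)) ≡ rowExpansion m k A r U
sum-weight≡rowExpansion zero    m A r U = refl
sum-weight≡rowExpansion (suc k) m A r U = begin
  sum (map (weight A r U) (allFuns (suc k) m))
    ≡⟨ sum-map-concatMap (weight A r U) _ (allFuns k m) ⟩
  sum (map (λ g → sum (map (weight A r U) (map (λ x → consF x g) (allFin m)))) (allFuns k m))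
    ≡⟨ cong sum (map-cong (λ g → cong sum (trans (sym (map-∘ (allFin m)))
                                                 (map-cong (λ x → weight-consF x g A r U) (allFin m))))
                          (allFuns k m)) ⟩
  sum (map (λ g → sum (map (λ x → t x g) (allFin m))) (allFuns k m))
    ≡⟨ sum-map-swap (λ g x → t x g) (allFuns k m) (allFin m) ⟩
  sum (map (λ x → sum (map (t x) (allFuns k m))) (allFin m))
    ≡⟨ cong sum (map-cong (λ x → sum-term (toℕ x)) (allFin m)) ⟩
  sum (map (expansionTerm m k A r U ∘ toℕ) (allFin m))
    ≡⟨ sum-allFin m _ ⟩
  rowExpansion m (suc k) A r U ∎
  where
  t : Fin m → (Fin k → Fin m) → ℕ
  t x g = zeroIf (U (toℕ x)) (A r (toℕ x) * weight A (suc r) (insert U (toℕ x)) g)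
  sum-term : ∀ y → sum (map (λ g → zeroIf (U y) (A r y * weight A (suc r) (insert U y) g)) (allFuns k m))
                   ≡ expansionTerm m k A r U y
  sum-term y with U y
  ... | true  = sum-map-0 (allFuns k m)
  ... | false = trans (sum-map-*ˡ (A r y) _ (allFuns k m))
                      (cong (A r y *_) (sum-weight≡rowExpansion k m A (suc r) (insert U y)))

per≡rowExpansion : ∀ n A → per {n} (toMat A) ≡ rowExpansion n n A 0 (λ _ → false)
per≡rowExpansion n A = begin
  per {n} (toMat A)
    ≡⟨ sum-map-filterᵇ isInjective _ (allFuns n n) ⟩
  sum (map (λ σ → if isInjective σ then rowProduct A 0 σ else 0) (allFuns n n))
    ≡⟨ cong sum (map-cong (λ σ → cong (λ b → if b then rowProduct A 0 σ else 0) (avoid-nothing σ)) (allFuns n n)) ⟩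
  sum (map (weight A 0 (λ _ → false)) (allFuns n n))
    ≡⟨ sum-weight≡rowExpansion n n A 0 (λ _ → false) ⟩
  rowExpansion n n A 0 (λ _ → false) ∎
  where
  avoid-nothing : ∀ σ → isInjective σ ≡ isInjective σ ∧ avoids (λ _ → false) σ
  avoid-nothing σ = sym (trans (cong (isInjective σ ∧_) (all-true (allFin n))) (∧-identityʳ (isInjective σ)))

h : ℕ → ℕ → ℕ
h i j =
  if i ≡ᵇ j then (if i ≡ᵇ 0 then 3 else 1)
  else if i ≡ᵇ suc j then 1
  else if j ≡ᵇ suc i then 2
  else 0

H≡h : ∀ n (i j : Fin n) → H n i j ≡ toMat h i j
H≡h n i j = cong (λ b → if b then (if toℕ i ≡ᵇ 0 then 3 else 1)
                          else if toℕ i ≡ᵇ suc (toℕ j) then 1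
                          else if toℕ j ≡ᵇ suc (toℕ i) then 2
                          else 0)
                   (≟-toℕ i j)

h-sub : ∀ j → h (suc j) j ≡ 1
h-sub j rewrite ≢⇒≡ᵇ-false (λ e → <⇒≢ (n<1+n j) (sym e)) | ≡ᵇ-refl j = refl

h-diag : ∀ j → h (suc j) (suc j) ≡ 1
h-diag j rewrite ≡ᵇ-refl j = refl

h-super : ∀ j → h (suc j) (suc (suc j)) ≡ 2
h-super j
  rewrite ≢⇒≡ᵇ-false (<⇒≢ (n<1+n j)) | ≢⇒≡ᵇ-false (<⇒≢ (m<n⇒m<1+n (n<1+n j))) | ≡ᵇ-refl j = refl

h-below : ∀ {i x} → suc x < i → h i x ≡ 0
h-below {i} {x} 1+x<i with <-trans (n<1+n x) 1+x<i
... | x<i rewrite ≢⇒≡ᵇ-false (λ e → <⇒≢ x<i (sym e)) | ≢⇒≡ᵇ-false (λ e → <⇒≢ 1+x<i (sym e))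
                | ≢⇒≡ᵇ-false (<⇒≢ (m<n⇒m<1+n x<i)) = refl

h-above : ∀ {i x} → suc i < x → h i x ≡ 0
h-above {i} {x} 1+i<x with <-trans (n<1+n i) 1+i<x
... | i<x rewrite ≢⇒≡ᵇ-false (<⇒≢ i<x) | ≢⇒≡ᵇ-false (<⇒≢ (m<n⇒m<1+n i<x))
                | ≢⇒≡ᵇ-false (λ e → <⇒≢ 1+i<x (sym e)) = refl

module _ {n : ℕ} where

  rowExpansion-h-band : ∀ k j U → suc k + suc j ≡ n →
    rowExpansion n (suc k) h (suc j) U ≡ sumTo (suc (suc k)) (λ y → expansionTerm n k h (suc j) U (y + j))
  rowExpansion-h-band k j U e = begin
    sumTo n term                                      ≡⟨ cong (λ m → sumTo m term) n≡j+2+k ⟩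
    sumTo (j + suc (suc k)) term                      ≡⟨ sumTo-skip j (suc (suc k)) below-band ⟩
    sumTo (suc (suc k)) (λ y → term (j + y))          ≡⟨ sumTo-cong (suc (suc k)) (λ y → cong term (+-comm j y)) ⟩
    sumTo (suc (suc k)) (λ y → term (y + j))          ∎
    where
    term : ℕ → ℕ
    term = expansionTerm n k h (suc j) U
    n≡j+2+k : n ≡ j + suc (suc k)
    n≡j+2+k = trans (sym e) (trans (cong suc (+-suc k j)) (+-comm (suc (suc k)) j))
    below-band : ∀ x → x < j → term x ≡ 0
    below-band x x<j = expansionTerm-entry≡0 n k h (suc j) U x (h-below (s≤s x<j))

  rowExpansion-h-band₃ : ∀ k j U → suc (suc k) + suc j ≡ n →
    let term = expansionTerm n (suc k) h (suc j) U in
    rowExpansion n (suc (suc k)) h (suc j) U ≡ term j + (term (suc j) + (term (suc (suc j)) + 0))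
  rowExpansion-h-band₃ k j U e = trans (rowExpansion-h-band (suc k) j U e)
    (sumTo-truncate 3 k (λ y → expansionTerm n (suc k) h (suc j) U (y + j)) above-band)
    where
    above-band : ∀ y → expansionTerm n (suc k) h (suc j) U (3 + y + j) ≡ 0
    above-band y = expansionTerm-entry≡0 n (suc k) h (suc j) U _ (h-above (s≤s (s≤s (s≤s (m≤n+m j y)))))

  next-row : ∀ k j → suc (suc k) + suc j ≡ n → suc k + suc (suc j) ≡ n
  next-row k j e = trans (cong suc (+-suc k (suc j))) e

  -- Row j+1 can only move on to column j+2, which reproduces the situation one row lower,
  -- until the last row finds no free column.
  rowExpansion-h-blocked : ∀ k j U → suc k + suc j ≡ n → U j ≡ true → U (suc j) ≡ true →
    rowExpansion n (suc k) h (suc j) U ≡ 0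
  rowExpansion-h-blocked zero j U e Uj Uj+1 = trans (rowExpansion-h-band 0 j U e)
    (cong₂ _+_ (expansionTerm-used n 0 h (suc j) U j Uj)
               (cong (_+ 0) (expansionTerm-used n 0 h (suc j) U (suc j) Uj+1)))
  rowExpansion-h-blocked (suc k) j U e Uj Uj+1 = trans (rowExpansion-h-band₃ k j U e)
    (cong₂ _+_ (expansionTerm-used n (suc k) h (suc j) U j Uj)
      (cong₂ _+_ (expansionTerm-used n (suc k) h (suc j) U (suc j) Uj+1)
        (cong (_+ 0) (expansionTerm-rest≡0 n (suc k) h (suc j) U (suc (suc j))
          (rowExpansion-h-blocked k (suc j) (insert U (suc (suc j))) (next-row k j e)
            (trans (insert-other U (<⇒≢ (n<1+n (suc j)))) Uj+1) (insert-self U (suc (suc j))))))))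

  rowExpansion-h-prefix : ∀ k j U → k + suc j ≡ n → U j ≡ true → FreeAbove j U →
    rowExpansion n k h (suc j) U ≡ J (suc k)
  rowExpansion-h-gap : ∀ k j U → suc k + suc j ≡ n →
    U j ≡ false → U (suc j) ≡ true → FreeAbove (suc j) U →
    rowExpansion n (suc k) h (suc j) U ≡ J (suc k)

  rowExpansion-h-prefix zero j U e Uj free = refl
  rowExpansion-h-prefix (suc zero) j U e Uj free = trans (rowExpansion-h-band 0 j U e)
    (cong₂ _+_ (expansionTerm-used n 0 h (suc j) U j Uj)
      (cong (_+ 0) (trans (expansionTerm-free n 0 h (suc j) U (suc j) (free (suc j) (n<1+n j)))
                          (cong (_* 1) (h-diag j)))))
  rowExpansion-h-prefix (suc (suc k)) j U e Uj free = begin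
    rowExpansion n (suc (suc k)) h (suc j) U
      ≡⟨ rowExpansion-h-band₃ k j U e ⟩
    term j + (term (suc j) + (term (suc (suc j)) + 0))
      ≡⟨ cong₂ _+_ (expansionTerm-used n (suc k) h (suc j) U j Uj) (cong₂ _+_
           (trans (expansionTerm-free n (suc k) h (suc j) U (suc j) Uj+1)
             (cong₂ _*_ (h-diag j)
               (rowExpansion-h-prefix (suc k) (suc j) (insert U (suc j)) (next-row k j e)
                 (insert-self U (suc j)) (insert-FreeAbove ≤-refl (FreeAbove-suc free)))))
           (cong (_+ 0) (trans (expansionTerm-free n (suc k) h (suc j) U (suc (suc j)) Uj+2)
             (cong₂ _*_ (h-super j)
               (rowExpansion-h-gap k (suc j) (insert U (suc (suc j))) (next-row k j e)
                 (trans (insert-other U (<⇒≢ (n<1+n (suc j)))) Uj+1) (insert-self U (suc (suc j)))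
                 (insert-FreeAbove ≤-refl (FreeAbove-suc (FreeAbove-suc free)))))))) ⟩
    0 + (1 * J (suc (suc k)) + (2 * J (suc k) + 0))
      ≡⟨ solve 2 (λ a b → con 0 :+ (con 1 :* a :+ (con 2 :* b :+ con 0)) := a :+ con 2 :* b) refl
               (J (suc (suc k))) (J (suc k)) ⟩
    J (suc (suc (suc k))) ∎
    where
    open +-*-Solver
    term : ℕ → ℕ
    term = expansionTerm n (suc k) h (suc j) U
    Uj+1 : U (suc j) ≡ false
    Uj+1 = free (suc j) (n<1+n j)
    Uj+2 : U (suc (suc j)) ≡ false
    Uj+2 = free (suc (suc j)) (m<n⇒m<1+n (n<1+n j))

  rowExpansion-h-gap zero j U e Uj Uj+1 free = trans (rowExpansion-h-band 0 j U e)
    (cong₂ _+_ (trans (expansionTerm-free n 0 h (suc j) U j Uj) (cong (_* 1) (h-sub j)))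
               (cong (_+ 0) (expansionTerm-used n 0 h (suc j) U (suc j) Uj+1)))
  rowExpansion-h-gap (suc k) j U e Uj Uj+1 free = begin
    rowExpansion n (suc (suc k)) h (suc j) U
      ≡⟨ rowExpansion-h-band₃ k j U e ⟩
    term j + (term (suc j) + (term (suc (suc j)) + 0))
      ≡⟨ cong₂ _+_
           (trans (expansionTerm-free n (suc k) h (suc j) U j Uj)
             (cong₂ _*_ (h-sub j)
               (rowExpansion-h-prefix (suc k) (suc j) (insert U j) (next-row k j e)
                 (trans (insert-other U (λ j+1≡j → <⇒≢ (n<1+n j) (sym j+1≡j))) Uj+1)
                 (insert-FreeAbove (n≤1+n j) free))))
           (cong₂ _+_ (expansionTerm-used n (suc k) h (suc j) U (suc j) Uj+1)
             (cong (_+ 0) (expansionTerm-rest≡0 n (suc k) h (suc j) U (suc (suc j))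
               (rowExpansion-h-blocked k (suc j) (insert U (suc (suc j))) (next-row k j e)
                 (trans (insert-other U (<⇒≢ (n<1+n (suc j)))) Uj+1) (insert-self U (suc (suc j))))))) ⟩
    1 * J (suc (suc k)) + 0
      ≡⟨ trans (+-identityʳ _) (*-identityˡ _) ⟩
    J (suc (suc k)) ∎
    where
    term : ℕ → ℕ
    term = expansionTerm n (suc k) h (suc j) U

rowExpansion-h : ∀ k → rowExpansion (2 + k) (2 + k) h 0 (λ _ → false) ≡ J (4 + k)
rowExpansion-h k = begin
  rowExpansion (2 + k) (2 + k) h 0 (λ _ → false)
    ≡⟨⟩
  3 * rowExpansion (2 + k) (suc k) h 1 (insert (λ _ → false) 0)
    + (2 * rowExpansion (2 + k) (suc k) h 1 (insert (λ _ → false) 1)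
       + sumTo k (λ y → expansionTerm (2 + k) (suc k) h 0 (λ _ → false) (2 + y)))
    ≡⟨ cong₂ _+_ (cong (3 *_) (rowExpansion-h-prefix (suc k) 0 _ e refl (insert-FreeAbove z≤n (λ _ _ → refl))))
                 (cong₂ _+_ (cong (2 *_) (rowExpansion-h-gap k 0 _ e refl refl (insert-FreeAbove ≤-refl (λ _ _ → refl))))
                            (sumTo-0 k (λ _ → refl))) ⟩
  3 * J (2 + k) + (2 * J (1 + k) + 0)
    ≡⟨ solve 2 (λ a b → con 3 :* a :+ (con 2 :* b :+ con 0) := (a :+ con 2 :* b) :+ con 2 :* a) refl
             (J (2 + k)) (J (1 + k)) ⟩
  J (4 + k) ∎
  where
  open +-*-Solver
  e : suc k + 1 ≡ 2 + k
  e = cong suc (+-comm k 1)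

per-cong : ∀ {n} {A B : Mat n} → (∀ i j → A i j ≡ B i j) → per A ≡ per B
per-cong {n} A≡B = cong sum (map-cong (λ σ → cong product (map-cong (λ i → A≡B i (σ i)) (allFin n))) (perms n))

contractAll-cong : ∀ k {A B : Mat (suc (suc k))} → (∀ i j → A i j ≡ B i j) →
  ∀ i j → contractAll A i j ≡ contractAll B i j
contractAll-cong zero    A≡B = A≡B
contractAll-cong (suc k) A≡B = contractAll-cong k contract-cong
  where
  contract-cong : ∀ i j → contract _ i j ≡ contract _ i j
  contract-cong zero    j = cong₂ _+_ (cong₂ _*_ (A≡B (suc zero) zero) (A≡B zero (suc j)))
                                      (cong₂ _*_ (A≡B zero zero) (A≡B (suc zero) (suc j)))
  contract-cong (suc i) j = A≡B (suc (suc i)) (suc j)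

hWithTop : ℕ → ℕ → ℕ → ℕ → ℕ
hWithTop α β zero    zero          = α
hWithTop α β zero    (suc zero)    = β
hWithTop α β zero    (suc (suc _)) = 0
hWithTop α β (suc i) j             = h (suc i) j

h≡hWithTop : ∀ i j → h i j ≡ hWithTop 3 2 i j
h≡hWithTop zero    zero          = refl
h≡hWithTop zero    (suc zero)    = refl
h≡hWithTop zero    (suc (suc _)) = refl
h≡hWithTop (suc i) j             = refl

contract-hWithTop : ∀ m α β (i j : Fin (suc m)) →
  contract (toMat (hWithTop α β)) i j ≡ toMat (hWithTop (α + β) (2 * α)) i j
contract-hWithTop m α β zero    j = top-row (toℕ j)
  where
  top-row : ∀ t → 1 * hWithTop α β 0 (suc t) + α * h 1 (suc t) ≡ hWithTop (α + β) (2 * α) 0 t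
  top-row zero          = trans (cong₂ _+_ (*-identityˡ β) (*-identityʳ α)) (+-comm β α)
  top-row (suc zero)    = *-comm α 2
  top-row (suc (suc t)) = *-zeroʳ α
contract-hWithTop m α β (suc i) j = refl

-- J (3 + m) + 2 * J (2 + m) reduces to J (4 + m): contracting jacobsthalTop m gives jacobsthalTop (suc m).
jacobsthalTop : ℕ → ℕ → ℕ → ℕ
jacobsthalTop m = hWithTop (J (3 + m)) (2 * J (2 + m))

contractAll-jacobsthalTop : ∀ k m i j →
  contractAll {k} (toMat (jacobsthalTop m)) i j ≡ toMat (jacobsthalTop (k + m)) i j
contractAll-jacobsthalTop zero    m i j = refl
contractAll-jacobsthalTop (suc k) m i j =
  trans (contractAll-cong k (contract-hWithTop (suc k) (J (3 + m)) (2 * J (2 + m))) i j)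
    (trans (contractAll-jacobsthalTop k (suc m) i j)
           (cong (λ t → toMat (jacobsthalTop t) i j) (+-suc k m)))

-- The two summands come from the transposition and the identity of Fin 2.
per-hWithTop : ∀ α β → per {2} (toMat (hWithTop α β)) ≡ α + β
per-hWithTop = solve 2 (λ α β → β :* (con 1 :* con 1) :+ (α :* (con 1 :* con 1) :+ con 0) := α :+ β) refl
  where open +-*-Solver

per-H : ∀ k → per (H (2 + k)) ≡ J (4 + k)
per-H k = begin
  per (H (2 + k))                            ≡⟨ per-cong (H≡h (2 + k)) ⟩
  per {2 + k} (toMat h)                    ≡⟨ per≡rowExpansion (2 + k) h ⟩
  rowExpansion (2 + k) (2 + k) h 0 (λ _ → false) ≡⟨ rowExpansion-h k ⟩
  J (4 + k)                                  ∎

per-contractAll-H : ∀ k → per (contractAll (H (2 + k))) ≡ J (4 + k)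
per-contractAll-H k = begin
  per (contractAll (H (2 + k)))
    ≡⟨ per-cong (contractAll-cong k (λ i j → trans (H≡h (2 + k) i j) (h≡hWithTop (toℕ i) (toℕ j)))) ⟩
  per (contractAll {k} (toMat (jacobsthalTop 0)))
    ≡⟨ per-cong (contractAll-jacobsthalTop k 0) ⟩
  per {2} (toMat (jacobsthalTop (k + 0)))
    ≡⟨ per-hWithTop (J (3 + (k + 0))) (2 * J (2 + (k + 0))) ⟩
  J (4 + (k + 0))
    ≡⟨ cong (λ t → J (4 + t)) (+-identityʳ k) ⟩
  J (4 + k) ∎

theorem1 : (k : ℕ) →
    (per (H (2 + k)) ≡ per (contractAll (H (2 + k)))) × (per (contractAll (H (2 + k))) ≡ J ((2 + k) + 2))
theorem1 k = trans (per-H k) (sym (per-contractAll-H k)) , trans (per-contractAll-H k) (cong J 4+k≡2+k+2)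
  where
  4+k≡2+k+2 : 4 + k ≡ (2 + k) + 2
  4+k≡2+k+2 = cong (2 +_) (+-comm 2 k)
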